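{- Let $\sigma$ be a partial assignment with exactly one variable $v\in V$ having $\sigma(v)=\star$, and let $(\sigma_0,\dots,\sigma_\ell)$ be any realization of $\mathsf{Path}(\sigma)$. Then \[|\mathcal{C}^{\sigma_\ell}_v|\le|\mathcal{C}^{\sigma_\ell}_{\star\text{ - }\mathsf{con}}|\le\Delta\cdot|\mathcal{C}^{\sigma_\ell}_{\star\text{ - }\mathsf{bad}}|.\]
   Context: CSP formula $\Phi=(V,\mathcal{Q},\mathcal{C})$: finite variable set $V=\{v_1,\dots,v_n\}$ (with this fixed ordering); finite domains $Q_v$, $q_v=|Q_v|\ge2$; constraints $c\in\mathcal{C}$ with scope $\mathsf{vbl}(c)$ and $c:\bigotimes_{u\in\mathsf{vbl}(c)}Q_u\to\{\mathtt{True},\mathtt{False}\}$. $q=\max q_v$, $k=\max|\mathsf{vbl}(c)|$, $\Delta=\max_c|\{c':\mathsf{vbl}(c)\cap\mathsf{vbl}(c')\ne\emptyset\}|$ (counting $c$); $\mathbb{P}$ uniform product distribution. Partial assignments $\sigma\in\bigotimes_v(Q_v\cup\{\star,\circ\})$ ($\star$ accessed unassigned, $\circ$ unaccessed); $\Lambda(\sigma)=\{v:\sigma(v)\in Q_v\}$, $\Lambda^+(\sigma)=\{v:\sigma(v)\ne\circ\}$; $\sigma_{u\gets x}$ replaces the value at $u$ by $x$; $\mathbb{P}[A\mid\sigma]$ conditions on agreement on $\Lambda(\sigma)$; $\sigma$ satisfies $c$ if all extensions do; $\mu_u^\sigma$ is the marginal at $u$ of the uniform distribution on satisfying assignments conditioned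 on agreeing with $\sigma$ on $\Lambda(\sigma)$. Parameters: $p'=(18\mathrm{e}^2q^2k\Delta^4)^{ -1}$, $\eta=(1-\mathrm{e}p'q)^{ -\Delta}-1$, $\zeta=(8\mathrm{e}qk\Delta^3)^{ -1}$, $\theta_u=1/q_u-\eta-\zeta$. Frozen/fixed: fix an oracle which on $(c,\sigma)$ answers "yes" if $\mathbb{P}[\neg c\mid\sigma]>p'$, "no" if $<0.99p'$, otherwise arbitrarily but consistently (depending only on $c$ and $\sigma|_{\mathsf{vbl}(c)}$). $\mathcal{C}^\sigma_{\mathsf{frozen}}$ = set of $c$ with answer "yes". $V^\sigma_{\mathsf{fix}}=\Lambda^+(\sigma)\cup\bigcup_{c\in\mathcal{C}^\sigma_{\mathsf{frozen}}}\mathsf{vbl}(c)$. Structures: $V^\sigma=V\setminus\Lambda(\sigma)$. $H^\sigma$ is the hypergraph with vertex set $V^\sigma$ having, for each $c\in\mathcal{C}$ not satisfied by $\sigma$, a hyperedge $c^\sigma$ with vertex set $\mathsf{vbl}(c)\setminus\Lambda(\sigma)$. For $v\in V^\sigma$, $\mathcal{C}^\sigma_v$ is the set of hyperedges of the connected component of $H^\sigma$ containing $v$ (and $\mathcal{C}^\sigma_v=\emptyset$ if $v\in\Lambda(\sigma)$). $H^\sigma_{\mathsf{fix}}$ is the sub-hypergraph with vertex set $V^\sigma\cap V^\sigma_{\mathsf{fix}}$ and the hyperedges of $H^\sigma$ contained in it. $V^\sigma_\star$ is the set of vertices in connected components of $H^\sigma_{\mathsf{fix}}$ containing some $v$ with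 $\sigma(v)=\star$. $V^\sigma_\partial=\{u\in V^\sigma\setminus V^\sigma_\star:$ some hyperedge of $H^\sigma$ contains $u$ and a vertex of $V^\sigma_\star\}$. $\mathsf{var}(\sigma)$ is the $v_i\in V^\sigma_\partial$ of smallest index, or $\perp$ if empty. Classes: $\mathcal{C}^\sigma_\star=\{c:\exists u\in\mathsf{vbl}(c),\sigma(u)=\star\}$; $\mathcal{C}^\sigma_{\star\text{ - }\mathsf{con}}=\{c:\mathsf{vbl}(c)\cap V^\sigma_\star\ne\emptyset\}$; $\mathcal{C}^\sigma_{\star\text{ - }\mathsf{frozen}}=\mathcal{C}^\sigma_{\mathsf{frozen}}\cap\mathcal{C}^\sigma_{\star\text{ - }\mathsf{con}}$; $\mathcal{C}^\sigma_{\star\text{ - }\mathsf{bad}}=\mathcal{C}^\sigma_\star\cup\mathcal{C}^\sigma_{\star\text{ - }\mathsf{frozen}}$. $\mathsf{Path}(\sigma)=(\sigma_0,\dots,\sigma_\ell)$ is the random sequence with $\sigma_0=\sigma$ and, for $i=0,1,\dots$: if $\mathsf{var}(\sigma_i)=\perp$ stop ($\ell=i$); otherwise with $u=\mathsf{var}(\sigma_i)$, set $\sigma_{i+1}=(\sigma_i)_{u\gets\star}$ with probability $\frac{1-q_u\theta_u}{2-q_u\theta_u}$ and $\sigma_{i+1}=(\sigma_i)_{u\gets x}$ with probability $\frac{\mu_u^{\sigma_i}(x)}{2-q_u\theta_u}$ for each $x\in Q_u$. -}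

module Defs where

open import Data.Nat using (ℕ; zero; suc; _+_; _*_; _^_; _≤_; _<_; _⊔_; _!)
open import Data.Nat.ListAction using (sum)
open import Data.Fin as Fin using (Fin; zero; suc)
open import Data.Fin.Subset using (Subset; _∈_)
open import Data.List using (List; []; _∷_; map; concatMap; foldr; allFin)
open import Data.Bool using (Bool; true; false; _∧_; not; if_then_else_)
open import Data.Product using (Σ; ∃; ∃-syntax; _×_; _,_)
open import Data.Sum using (_⊎_)
open import Relation.Nullary using (¬_)
open import Relation.Nullary.Decidable using (⌊_⌋)
open import Relation.Binary.PropositionalEquality using (_≡_; _≢_)

countL : ∀ {A : Set} → (A → Bool) → List A → ℕ
countL f xs = sum (map (λ x → if f x then 1 else 0) xs)

allL : ∀ {A : Set} → (A → Bool) → List A → Bool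
allL f = foldr (λ x b → f x ∧ b) true

anyL : ∀ {A : Set} → (A → Bool) → List A → Bool
anyL f = foldr (λ x b → if f x then true else b) false

maxL : List ℕ → ℕ
maxL = foldr _⊔_ 0

consA : ∀ {n} {d : Fin (suc n) → ℕ} → Fin (d zero) →
        ((i : Fin n) → Fin (d (suc i))) → (v : Fin (suc n)) → Fin (d v)
consA x f zero    = x
consA x f (suc i) = f i

allAsg : (n : ℕ) (d : Fin n → ℕ) → List ((v : Fin n) → Fin (d v))
allAsg zero    d = (λ ()) ∷ []
allAsg (suc n) d =
  concatMap (λ x → map (λ f → consA {n} {d} x f) (allAsg n (λ i → d (suc i))))
            (allFin (d zero))

Represents : ∀ {m} → Subset m → (Fin m → Set) → Set
Represents {m} S P = (c : Fin m) → (c ∈ S → P c) × (P c → c ∈ S)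

-- Exact rational comparisons involving e² (no reals available).
-- S_N = Σ_{i≤N} 2^i / i!  ;  T N = S_N · N!  (a natural number)
T : ℕ → ℕ
T zero    = 1
T (suc N) = suc N * T N + 2 ^ suc N

-- "e² · x > y"  iff  some partial sum S_N satisfies S_N · x > y
e²·_>_ : ℕ → ℕ → Set
e²· x > y = ∃[ N ] (y * N ! < x * T N)

-- upper bounds U_N = S_N + 2^(N+2)/(N+1)! ≥ e² for N ≥ 2, U_N → e².
-- With N = M + 2:  U_N · (N+1)! = (N+1)·T N + 2^(N+2).
-- "e² · x < y"  iff  some upper bound U_N (N ≥ 2) satisfies U_N · x < y
e²·_<_ : ℕ → ℕ → Set
e²· x < y = ∃[ M ] (x * (suc (M + 2) * T (M + 2) + 2 ^ (M + 4)) < y * (suc (M + 2)) !)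

record CSP : Set₁ where
  field
    n       : ℕ                       -- variables v_1..v_n as Fin n (this ordering)
    dom     : Fin n → ℕ               -- q_v ; domain Q_v = Fin (q_v)
    dom≥2   : ∀ v → 2 ≤ dom v
    m       : ℕ
    inScope : Fin m → Fin n → Bool
    eval    : Fin m → ((v : Fin n) → Fin (dom v)) → Bool
    local   : ∀ c α β → (∀ v → inScope c v ≡ true → α v ≡ β v) → eval c α ≡ eval c β

data Val (k : ℕ) : Set where
  val  : Fin k → Val k
  star : Val k      -- ⋆ : accessed but unassigned
  circ : Val k      -- ∘ : unaccessed

module _ (Φ : CSP) where
  open CSP Φ

  Asg : Set
  Asg = (v : Fin n) → Fin (dom v)

  PA : Set
  PA = (v : Fin n) → Val (dom v)

  qmax : ℕ
  qmax = maxL (map dom (allFin n))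

  kmax : ℕ
  kmax = maxL (map (λ c → countL (inScope c) (allFin n)) (allFin m))

  intersects : Fin m → Fin m → Bool
  intersects c c' = anyL (λ v → inScope c v ∧ inScope c' v) (allFin n)

  Δ : ℕ
  Δ = maxL (map (λ c → countL (intersects c) (allFin m)) (allFin m))

  -- K = q² k Δ⁴ so that p' = 1 / (18 e² K)
  Kp : ℕ
  Kp = qmax * qmax * kmax * Δ ^ 4

  Assigned : PA → Fin n → Set
  Assigned σ v = ∃[ x ] (σ v ≡ val x)

  InΛ⁺ : PA → Fin n → Set
  InΛ⁺ σ v = σ v ≢ circ

  Agrees : PA → Asg → Set
  Agrees σ α = ∀ v x → σ v ≡ val x → α v ≡ x

  agreeB : PA → Asg → Bool
  agreeB σ α = allL (λ v → matchV (σ v) (α v)) (allFin n)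
    where
    matchV : ∀ {k} → Val k → Fin k → Bool
    matchV (val x) y = ⌊ x Fin.≟ y ⌋
    matchV star    y = true
    matchV circ    y = true

  -- P[¬c | σ] = violB / agreeCount
  violCount : Fin m → PA → ℕ
  violCount c σ = countL (λ α → agreeB σ α ∧ not (eval c α)) (allAsg n dom)

  agreeCount : PA → ℕ
  agreeCount σ = countL (agreeB σ) (allAsg n dom)

  SatAll : Asg → Set
  SatAll α = ∀ c → eval c α ≡ true

  Satisfies : PA → Fin m → Set
  Satisfies σ c = ∀ α → Agrees σ α → eval c α ≡ true

  record Oracle : Set where
    field
      frozen     : Fin m → PA → Bool
      consistent : ∀ c σ τ → (∀ v → inScope c v ≡ true → σ v ≡ τ v) →
                   frozen c σ ≡ frozen c τ
      -- P[¬c|σ] > p'  ⇔  e² · 18 K · a > b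
      yes-spec   : ∀ c σ → e²· (18 * Kp * violCount c σ) > agreeCount σ →
                   frozen c σ ≡ true
      -- P[¬c|σ] < 0.99 p'  ⇔  e² · 1800 K · a < 99 b
      no-spec    : ∀ c σ → e²· (1800 * Kp * violCount c σ) < (99 * agreeCount σ) →
                   frozen c σ ≡ false

  module Structures (O : Oracle) (σ : PA) where
    open Oracle O

    InVσ : Fin n → Set
    InVσ v = ¬ Assigned σ v

    Edge : Fin m → Set
    Edge c = ¬ Satisfies σ c

    InEdge : Fin m → Fin n → Set
    InEdge c w = inScope c w ≡ true × InVσ w

    data Conn (v : Fin n) : Fin n → Set where
      here : InVσ v → Conn v v
      step : ∀ {w w'} c → Conn v w → Edge c → InEdge c w → InEdge c w' → Conn v w'

    Cv : Fin n → Fin m → Set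
    Cv v c = Edge c × ∃[ w ] (InEdge c w × Conn v w)

    Frozen : Fin m → Set
    Frozen c = frozen c σ ≡ true

    Vfix : Fin n → Set
    Vfix w = InΛ⁺ σ w ⊎ ∃[ c ] (Frozen c × inScope c w ≡ true)

    EdgeFix : Fin m → Set
    EdgeFix c = Edge c × (∀ w → InEdge c w → Vfix w)

    data ConnFix (v : Fin n) : Fin n → Set where
      here : InVσ v → Vfix v → ConnFix v v
      step : ∀ {w w'} c → ConnFix v w → EdgeFix c → InEdge c w → InEdge c w' →
             ConnFix v w'

    Vstar : Fin n → Set
    Vstar w = ∃[ v ] (σ v ≡ star × ConnFix v w)

    Vbdry : Fin n → Set
    Vbdry u = InVσ u × ¬ Vstar u × ∃[ c ] (Edge c × InEdge c u × ∃[ w ] (InEdge c w × Vstar w))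

    IsVar : Fin n → Set
    IsVar u = Vbdry u × (∀ w → w Fin.< u → ¬ Vbdry w)

    VarBot : Set
    VarBot = ∀ u → ¬ Vbdry u

    Cstar : Fin m → Set
    Cstar c = ∃[ u ] (inScope c u ≡ true × σ u ≡ star)

    CstarCon : Fin m → Set
    CstarCon c = ∃[ u ] (inScope c u ≡ true × Vstar u)

    CstarFrozen : Fin m → Set
    CstarFrozen c = Frozen c × CstarCon c

    CstarBad : Fin m → Set
    CstarBad c = Cstar c ⊎ CstarFrozen c

    MuPos : (u : Fin n) → Fin (dom u) → Set
    MuPos u x = ∃[ α ] (SatAll α × Agrees σ α × α u ≡ x)

  record IsPathRealization (O : Oracle) (σ : PA) (ℓ : ℕ) (path : ℕ → PA) : Set where
    open Structures O
    field
      start : ∀ v → path 0 v ≡ σ v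
      steps : ∀ i → i < ℓ → ∃[ u ] (IsVar (path i) u ×
                (∀ w → w ≢ u → path (suc i) w ≡ path i w) ×
                (path (suc i) u ≡ star ⊎
                 ∃[ x ] (MuPos (path i) u x × path (suc i) u ≡ val x)))
      stop  : VarBot (path ℓ)

{-# OPTIONS --safe #-}
-- Along the path every ⋆ stays ⋆, since var(·) only ever picks boundary vertices, which lie
-- outside V⋆; so v ∈ V⋆ at the end.  There var = ⊥, i.e. V⋆ has no boundary, so V⋆ is closed
-- under connectivity in H^σ and every hyperedge of the component of v meets V⋆.  For the second
-- inequality, a vertex u ∈ V⋆ is fixed: either σ(u) = ⋆, and any constraint through u is ⋆-bad,
-- or u lies in a frozen constraint, which is then ⋆-frozen.  So every ⋆-connected constraint
-- meets a ⋆-bad one, and each ⋆-bad constraint meets at most Δ constraints.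
module Submission where

open import Defs
open import Data.Nat using (ℕ; zero; suc; _+_; _≤_; _*_; z≤n)
open import Data.Nat.Properties
  using ( +-*-semiring; ≤-refl; ≤-trans; <⇒≤; +-mono-≤; *-monoʳ-≤; *-comm
        ; m≤m+n; m≤n+m; m≤m⊔n; m≤n⊔m; module ≤-Reasoning)
open import Data.Fin using (Fin; zero; suc)
open import Data.Fin.Subset using (Subset; ∣_∣; _∈_; _⊆_)
open import Data.Fin.Subset.Properties using (_∈?_; p⊆q⇒∣p∣≤∣q∣)
open import Data.Bool using (Bool; true; false; if_then_else_; _∧_)
open import Data.Vec using ([]; _∷_; lookup)
open import Data.Vec.Properties using ([]=⇒lookup; lookup⇒[]=)
open import Data.List using (_∷_; tabulate; allFin)
open import Data.List.Membership.Propositional using () renaming (_∈_ to _∈ˡ_)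
open import Data.List.Membership.Propositional.Properties using (∈-map⁺; ∈-allFin)
open import Data.List.Relation.Unary.Any using (here; there)
open import Data.Product using (_×_; ∃-syntax; _,_; proj₁; proj₂)
open import Data.Sum using (inj₁; inj₂)
open import Data.Empty using (⊥-elim)
open import Function using (_∘_)
open import Relation.Nullary using (¬_)
open import Relation.Nullary.Negation using (¬¬-map)
open import Relation.Nullary.Decidable using (decidable-stable)
open import Relation.Binary.PropositionalEquality
  using (_≡_; _≢_; refl; sym; trans; cong; cong₂; subst)
open import Algebra.Properties.Semiring.Sum +-*-semiring
  using (sum; sum-syntax; sum-cong-≗; ∑-comm; *-distribˡ-sum; *-distribʳ-sum)

indicator : Bool → ℕ
indicator b = if b then 1 else 0

indicator-true : ∀ {b} → b ≡ true → indicator b ≡ 1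
indicator-true refl = refl

∑-mono-≤ : ∀ {m} {f g : Fin m → ℕ} → (∀ i → f i ≤ g i) → sum f ≤ sum g
∑-mono-≤ {zero}  f≤g = z≤n
∑-mono-≤ {suc m} f≤g = +-mono-≤ (f≤g zero) (∑-mono-≤ (f≤g ∘ suc))

term≤∑ : ∀ {m} (f : Fin m → ℕ) i → f i ≤ sum f
term≤∑ f zero    = m≤m+n _ _
term≤∑ f (suc i) = ≤-trans (term≤∑ (f ∘ suc) i) (m≤n+m _ _)

∣p∣≡∑indicator : ∀ {m} (p : Subset m) → ∣ p ∣ ≡ ∑[ i < m ] indicator (lookup p i)
∣p∣≡∑indicator []          = refl
∣p∣≡∑indicator (true ∷ p)  = cong suc (∣p∣≡∑indicator p)
∣p∣≡∑indicator (false ∷ p) = ∣p∣≡∑indicator p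

countL-tabulate : ∀ {A : Set} {m} (f : A → Bool) (g : Fin m → A) →
                  countL f (tabulate g) ≡ ∑[ i < m ] indicator (f (g i))
countL-tabulate {m = zero}  f g = refl
countL-tabulate {m = suc m} f g = cong (indicator (f (g zero)) +_) (countL-tabulate f (g ∘ suc))

∈⇒≤maxL : ∀ {x xs} → x ∈ˡ xs → x ≤ maxL xs
∈⇒≤maxL (here refl) = m≤m⊔n _ _
∈⇒≤maxL (there x∈) = ≤-trans (∈⇒≤maxL x∈) (m≤n⊔m _ _)

anyL-complete : ∀ {A : Set} {f : A → Bool} {x xs} → x ∈ˡ xs → f x ≡ true → anyL f xs ≡ true
anyL-complete (here refl) fx≡true rewrite fx≡true = refl
anyL-complete {f = f} {xs = y ∷ _} (there x∈) fx≡true with f y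
... | true  = refl
... | false = anyL-complete x∈ fx≡true

-- Double counting of the pairs (c , c') with c ∈ p, c' ∈ q and R c' c.
covered⇒∣p∣≤D*∣q∣ : ∀ {m} (p q : Subset m) (R : Fin m → Fin m → Bool) {D : ℕ} →
  (∀ c → c ∈ p → ∃[ c' ] (c' ∈ q × R c' c ≡ true)) →
  (∀ c' → ∑[ c < m ] indicator (R c' c) ≤ D) →
  ∣ p ∣ ≤ D * ∣ q ∣
covered⇒∣p∣≤D*∣q∣ {m} p q R {D} covered degree≤D = begin
  ∣ p ∣
    ≡⟨ ∣p∣≡∑indicator p ⟩
  ∑[ c < m ] indicator (lookup p c)
    ≤⟨ ∑-mono-≤ p≤pairs ⟩
  ∑[ c < m ] ∑[ c' < m ] pair c' c
    ≡⟨ ∑-comm (λ c c' → pair c' c) ⟩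
  ∑[ c' < m ] ∑[ c < m ] pair c' c
    ≡⟨ sum-cong-≗ (λ c' → *-distribˡ-sum (q? c') (λ c → indicator (R c' c))) ⟨
  ∑[ c' < m ] (q? c' * ∑[ c < m ] indicator (R c' c))
    ≤⟨ ∑-mono-≤ (λ c' → *-monoʳ-≤ (q? c') (degree≤D c')) ⟩
  ∑[ c' < m ] (q? c' * D)
    ≡⟨ *-distribʳ-sum D q? ⟨
  (∑[ c' < m ] q? c') * D
    ≡⟨ cong (_* D) (∣p∣≡∑indicator q) ⟨
  ∣ q ∣ * D
    ≡⟨ *-comm ∣ q ∣ D ⟩
  D * ∣ q ∣
    ∎
  where
  open ≤-Reasoning

  q? : Fin m → ℕ
  q? c' = indicator (lookup q c')

  pair : Fin m → Fin m → ℕ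
  pair c' c = q? c' * indicator (R c' c)

  p≤pairs : ∀ c → indicator (lookup p c) ≤ ∑[ c' < m ] pair c' c
  p≤pairs c with lookup p c in c∈?p
  ... | false = z≤n
  ... | true with covered c (lookup⇒[]= c p c∈?p)
  ... | c' , c'∈q , Rc'c =
    subst (_≤ ∑[ c'' < m ] pair c'' c) pair≡1 (term≤∑ (λ c'' → pair c'' c) c')
    where
    pair≡1 : pair c' c ≡ 1
    pair≡1 = cong₂ _*_ (indicator-true ([]=⇒lookup c'∈q)) (indicator-true Rc'c)

Represents-⊆ : ∀ {m} {p q : Subset m} {P Q : Fin m → Set} →
  Represents p P → Represents q Q → (∀ c → P c → ¬ ¬ Q c) → p ⊆ q
Represents-⊆ {q = q} p≈P q≈Q P⇒¬¬Q {c} c∈p =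
  decidable-stable (c ∈? q) (¬¬-map (proj₂ (q≈Q c)) (P⇒¬¬Q c (proj₁ (p≈P c) c∈p)))

⋆-unassigned : ∀ {k} {a : Val k} → a ≡ star → ¬ (∃[ x ] (a ≡ val x))
⋆-unassigned refl (_ , ())

⋆-accessed : ∀ {k} {a : Val k} → a ≡ star → a ≢ circ
⋆-accessed refl ()

unassigned-accessed⇒⋆ : ∀ {k} {a : Val k} → ¬ (∃[ x ] (a ≡ val x)) → a ≢ circ → a ≡ star
unassigned-accessed⇒⋆ {a = val x} unassigned _ = ⊥-elim (unassigned (x , refl))
unassigned-accessed⇒⋆ {a = star}  _ _ = refl
unassigned-accessed⇒⋆ {a = circ}  _ accessed = ⊥-elim (accessed refl)

module _ (Φ : CSP) where
  open CSP Φ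

  common-variable⇒intersects : ∀ {c c' u} → inScope c u ≡ true → inScope c' u ≡ true →
                               intersects Φ c c' ≡ true
  common-variable⇒intersects {u = u} u∈c u∈c' = anyL-complete (∈-allFin u) (cong₂ _∧_ u∈c u∈c')

  intersection-degree≤Δ : ∀ c → ∑[ c' < m ] indicator (intersects Φ c c') ≤ Δ Φ
  intersection-degree≤Δ c = subst (_≤ Δ Φ) (countL-tabulate (intersects Φ c) (λ c' → c'))
    (∈⇒≤maxL (∈-map⁺ (λ c → countL (intersects Φ c) (allFin m)) (∈-allFin c)))

  module StructureProperties (O : Oracle Φ) (τ : PA Φ) where
    open Structures Φ O τ

    ⋆⇒Vstar : ∀ {v} → τ v ≡ star → Vstar v
    ⋆⇒Vstar τv≡⋆ = _ , τv≡⋆ , here (⋆-unassigned τv≡⋆) (inj₁ (⋆-accessed τv≡⋆))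

    ConnFix⇒InVσ×Vfix : ∀ {v w} → ConnFix v w → InVσ w × Vfix w
    ConnFix⇒InVσ×Vfix (here w∈V w∈fix)            = w∈V , w∈fix
    ConnFix⇒InVσ×Vfix (step _ _ (_ , e⊆fix) _ w∈e) = proj₂ w∈e , e⊆fix _ w∈e

    CstarCon⇒intersects-CstarBad : ∀ c → CstarCon c →
                                   ∃[ c' ] (CstarBad c' × intersects Φ c' c ≡ true)
    CstarCon⇒intersects-CstarBad c (u , u∈c , u∈V⋆@(_ , _ , conn)) with ConnFix⇒InVσ×Vfix conn
    ... | _ , inj₂ (c' , c'-frozen , u∈c') =
      c' , inj₂ (c'-frozen , u , u∈c' , u∈V⋆) , common-variable⇒intersects u∈c' u∈c
    ... | u-unassigned , inj₁ u-accessed =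
      c , inj₁ (u , u∈c , unassigned-accessed⇒⋆ u-unassigned u-accessed) ,
      common-variable⇒intersects u∈c u∈c

    -- Vstar need not be decidable, so only its double negation propagates.
    VarBot⇒Conn-preserves-Vstar : VarBot → ∀ {v w} → Vstar v → Conn v w → ¬ ¬ Vstar w
    VarBot⇒Conn-preserves-Vstar no-var v∈V⋆ (here _) w∉V⋆ = w∉V⋆ v∈V⋆
    VarBot⇒Conn-preserves-Vstar no-var v∈V⋆ (step {w} {w'} c conn e w∈e w'∈e) w'∉V⋆ =
      VarBot⇒Conn-preserves-Vstar no-var v∈V⋆ conn
        (λ w∈V⋆ → no-var w' (proj₂ w'∈e , w'∉V⋆ , c , e , w'∈e , w , w∈e , w∈V⋆))

    VarBot⇒Cv⊆CstarCon : VarBot → ∀ {v} → Vstar v → ∀ c → Cv v c → ¬ ¬ CstarCon c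
    VarBot⇒Cv⊆CstarCon no-var v∈V⋆ c (_ , w , (w∈c , _) , conn) =
      ¬¬-map (λ w∈V⋆ → w , w∈c , w∈V⋆) (VarBot⇒Conn-preserves-Vstar no-var v∈V⋆ conn)

  ⋆-persists-along-path : ∀ {O σ ℓ path} → IsPathRealization Φ O σ ℓ path →
                          ∀ {v} → σ v ≡ star → ∀ i → i ≤ ℓ → path i v ≡ star
  ⋆-persists-along-path run {v} σv≡⋆ zero _ = trans (IsPathRealization.start run v) σv≡⋆
  ⋆-persists-along-path {O} {path = path} run {v} σv≡⋆ (suc i) i<ℓ
    with IsPathRealization.steps run i i<ℓ
  ... | u , (u∈∂ , _) , unchanged-off-u , _ = trans (unchanged-off-u v v≢u) pathᵢv≡⋆
    where
    pathᵢv≡⋆ : path i v ≡ star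
    pathᵢv≡⋆ = ⋆-persists-along-path run σv≡⋆ i (<⇒≤ i<ℓ)

    v≢u : v ≢ u
    v≢u refl = proj₁ (proj₂ u∈∂) (StructureProperties.⋆⇒Vstar O (path i) pathᵢv≡⋆)

lemma6p30 : (Φ : CSP) (O : Oracle Φ) (σ : PA Φ) (v : Fin (CSP.n Φ)) →
    σ v ≡ star → (∀ w → σ w ≡ star → w ≡ v) →
    (ℓ : ℕ) (path : ℕ → PA Φ) → IsPathRealization Φ O σ ℓ path →
    (S₁ S₂ S₃ : Subset (CSP.m Φ)) →
    Represents S₁ (Structures.Cv Φ O (path ℓ) v) →
    Represents S₂ (Structures.CstarCon Φ O (path ℓ)) →
    Represents S₃ (Structures.CstarBad Φ O (path ℓ)) →
    ∣ S₁ ∣ ≤ ∣ S₂ ∣ × ∣ S₂ ∣ ≤ Δ Φ * ∣ S₃ ∣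
lemma6p30 Φ O σ v σv≡⋆ _ ℓ path run S₁ S₂ S₃ S₁≈Cv S₂≈CstarCon S₃≈CstarBad =
    p⊆q⇒∣p∣≤∣q∣ (Represents-⊆ S₁≈Cv S₂≈CstarCon (VarBot⇒Cv⊆CstarCon no-var v∈V⋆))
  , covered⇒∣p∣≤D*∣q∣ S₂ S₃ (intersects Φ) S₂-covered (intersection-degree≤Δ Φ)
  where
  open StructureProperties Φ O (path ℓ)

  no-var : Structures.VarBot Φ O (path ℓ)
  no-var = IsPathRealization.stop run

  v∈V⋆ : Structures.Vstar Φ O (path ℓ) v
  v∈V⋆ = ⋆⇒Vstar (⋆-persists-along-path Φ run σv≡⋆ ℓ ≤-refl)

  S₂-covered : ∀ c → c ∈ S₂ → ∃[ c' ] (c' ∈ S₃ × intersects Φ c' c ≡ true)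
  S₂-covered c c∈S₂ with CstarCon⇒intersects-CstarBad c (proj₁ (S₂≈CstarCon c) c∈S₂)
  ... | c' , c'-bad , c'∩c = c' , proj₂ (S₃≈CstarBad c') c'-bad , c'∩c
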